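{- Let $P_n$ be an oriented path $v_1\to v_2\to\cdots\to v_n$ with pebbling assignment $(S_{P_n})$ placing four or five pebbles on some vertex $v_j$, zero pebbles on the following vertex $v_{j+1}$, zero or one pebble on every other non-sink vertex, and $m$ pebbles on the sink $v_n$. Suppose exactly $n-2$ of the edges of $P_n$ are traversable. Then $P_n\cong [S_{P_n}]$ as directed graphs.
   Context: A pebbling move along an edge $(v,w)$ (allowed when $v$ has at least two pebbles) removes two pebbles from $v$ and adds one pebble to $w$. An edge $(v,w)$ is traversable if some assignment reachable from $(S_{P_n})$ by pebbling moves admits a pebbling move along $(v,w)$. The assignment graph $[S_{P_n}]$ is the directed graph whose vertices are all assignments obtainable from $(S_{P_n})$ by finite sequences of pebbling moves (including $(S_{P_n})$ itself), with a directed edge from $A$ to $B$ whenever $B$ is obtained from $A$ by a single pebbling move. -}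

module Defs where

open import Data.Nat using (ℕ; suc; _≤_; _∸_)
open import Data.Nat.Properties using ()
open import Data.Fin using (Fin; inject₁; fromℕ; toℕ)
open import Data.Fin.Subset using (Subset; _∈_; ∣_∣)
open import Data.Vec using (Vec; lookup; _[_]%=_)
open import Data.Product using (Σ; ∃; _×_; _,_)
open import Data.Sum using (_⊎_)
open import Function.Bundles using (_⇔_)
open import Function.Definitions using (Injective)
open import Relation.Binary.PropositionalEquality using (_≡_; _≢_)
open import Relation.Binary.Construct.Closure.ReflexiveTransitive using (Star)

-- Oriented path P_n with n = suc k vertices v_0 → v_1 → … → v_k (0-indexed).
-- Edge e : Fin k goes from vertex (inject₁ e) to vertex (suc e).
-- The sink is vertex fromℕ k.

Assignment : ℕ → Set
Assignment k = Vec ℕ (suc k)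

Move : {k : ℕ} → Fin k → Assignment k → Assignment k → Set
Move e A B =
  (2 ≤ lookup A (inject₁ e)) × (B ≡ ((A [ inject₁ e ]%= (λ x → x ∸ 2)) [ Fin.suc e ]%= suc))
  where import Data.Fin as Fin

Step : {k : ℕ} → Assignment k → Assignment k → Set
Step A B = ∃ λ e → Move e A B

Reachable : {k : ℕ} → Assignment k → Assignment k → Set
Reachable = Star Step

Traversable : {k : ℕ} → Assignment k → Fin k → Set
Traversable S e = ∃ λ B → Reachable S B × (2 ≤ lookup B (inject₁ e))

ExactlyTraversable : {k : ℕ} → Assignment k → ℕ → Set
ExactlyTraversable {k} S t =
  Σ (Subset k) λ T → (∀ e → (e ∈ T) ⇔ Traversable S e) × (∣ T ∣ ≡ t)

IsSpecialAssignment : {k : ℕ} → Assignment k → Fin k → ℕ → Set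
IsSpecialAssignment {k} S j m =
  ((lookup S (inject₁ j) ≡ 4) ⊎ (lookup S (inject₁ j) ≡ 5))
  × (lookup S (Fin.suc j) ≡ 0)
  × (∀ (i : Fin k) → i ≢ j → inject₁ i ≢ Fin.suc j → lookup S (inject₁ i) ≤ 1)
  × (lookup S (fromℕ k) ≡ m)
  where import Data.Fin as Fin

PathIsoAssignmentGraph : {k : ℕ} → Assignment k → Set
PathIsoAssignmentGraph {k} S =
  Σ (Fin (suc k) → Assignment k) λ f →
    (∀ i → Reachable S (f i))
    × (∀ B → Reachable S B → ∃ λ i → f i ≡ B)
    × Injective _≡_ _≡_ f
    × (∀ i i' → Step (f i) (f i') ⇔ (toℕ i' ≡ suc (toℕ i)))

{-# OPTIONS --safe #-}
-- From S the play is forced. The loaded vertex v_j fires twice, which leaves at most one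
-- pebble on it and two on v_{j+1}; that pair then cascades forward through the vertices
-- holding one pebble, until it reaches an empty vertex or the sink. Every reachable
-- assignment therefore admits at most one move, so [S] is a directed path whose s moves
-- use the edges j, j, j+1, …, j+s-2; its assignments are distinct because each move
-- loses a pebble. The traversable edges form an interval of s-1 edges, so having exactly
-- n-2 of them means s = n-1: [S] has n vertices and is isomorphic to P_n.
module Submission where

open import Defs
open import Data.Nat using (ℕ; zero; suc; _∸_; _+_; _≤_; _<_; z≤n; s≤s; pred)
open import Data.Nat.Properties
  using ( ≤-refl; ≤-pred; <⇒≤; <⇒≱; n≮0; n≤0⇒n≡0; pred-mono-≤; m≤m+n; m+n≤o⇒n≤o
        ; +-monoʳ-<; +-suc; +-identityʳ; +-cancelˡ-≡; m<n+o⇒m∸n<o; m+[n∸m]≡n )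
open import Data.Fin using (Fin; zero; suc; inject₁; fromℕ<; toℕ)
open import Data.Fin.Properties using (toℕ-injective; toℕ<n; toℕ-fromℕ<; suc-injective)
open import Data.Fin.Subset using (Subset; _∈_; ∣_∣; inside; outside)
open import Data.Fin.Subset.Properties using (drop-there)
open import Data.Vec using (Vec; []; _∷_; lookup; sum)
open import Data.Vec.Base using (here; there)
open import Data.Product using (Σ; ∃; _×_; _,_; proj₁; proj₂; map)
open import Data.Sum using (_⊎_; inj₁; inj₂)
open import Data.Empty using (⊥-elim)
open import Data.Unit using (⊤; tt)
open import Function using (_∘_; id)
open import Relation.Nullary using (¬_)
open import Function.Bundles using (_⇔_; mk⇔; Equivalence)
open import Function.Construct.Composition using (_⇔-∘_)
open import Relation.Binary.PropositionalEquality
  using (_≡_; _≢_; refl; sym; trans; cong; subst; module ≡-Reasoning)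
open import Relation.Binary.Construct.Closure.ReflexiveTransitive using (ε; _◅_; _◅◅_)

Sparse : ∀ {n} → Vec ℕ n → Set
Sparse []           = ⊤
Sparse (x ∷ [])     = ⊤
Sparse (x ∷ y ∷ zs) = x ≤ 1 × Sparse (y ∷ zs)

sparse-∷ : ∀ {n x} {xs : Vec ℕ n} → x ≤ 1 → Sparse xs → Sparse (x ∷ xs)
sparse-∷ {xs = []}    _   _  = tt
sparse-∷ {xs = _ ∷ _} x≤1 sp = x≤1 , sp

sparse-from-lookup : ∀ {n} (xs : Vec ℕ (suc n)) → (∀ i → lookup xs (inject₁ i) ≤ 1) → Sparse xs
sparse-from-lookup (x ∷ [])     _     = tt
sparse-from-lookup (x ∷ y ∷ zs) small = small zero , sparse-from-lookup (y ∷ zs) (small ∘ suc)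

sparse-no-move : ∀ {k} {A : Assignment k} → Sparse A → ∀ e B → ¬ Move e A B
sparse-no-move {A = x ∷ y ∷ zs} (x≤1 , _) zero    _ (2≤x , _) = <⇒≱ 2≤x x≤1
sparse-no-move {A = x ∷ y ∷ zs} (_ , sp)  (suc e) _ (2≤  , _) = sparse-no-move sp e _ (2≤ , refl)

-- The assignment graph of A is the path state 0 → ⋯ → state steps, the t-th move being along edge t.
record ForcedRun {k : ℕ} (A : Assignment k) (edge : ℕ → ℕ) : Set where
  field
    steps   : ℕ
    state   : ℕ → Assignment k
    state-0 : state 0 ≡ A
    move    : ∀ t → t < steps
            → Σ (Fin k) λ e → toℕ e ≡ edge t × Move e (state t) (state (suc t))
    forced  : ∀ t → t ≤ steps → ∀ e B → Move e (state t) B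
            → t < steps × toℕ e ≡ edge t × B ≡ state (suc t)

open ForcedRun

stuck-run : ∀ {k} {A : Assignment k} {edge} → Sparse A → ForcedRun A edge
stuck-run {A = A} sp = record
  { steps = 0 ; state = λ _ → A ; state-0 = refl ; move = λ _ ()
  ; forced = λ { _ z≤n e B mv → ⊥-elim (sparse-no-move sp e B mv) } }

head-move : ∀ {n x y} {ys : Vec ℕ n} {edge} → Sparse (y ∷ ys) → edge 0 ≡ 0
  → ForcedRun (x ∷ suc y ∷ ys) (edge ∘ suc) → ForcedRun (2 + x ∷ y ∷ ys) edge
head-move {x = x} {y} {ys} {edge} sp e₀ run = record
  { steps = suc (steps run) ; state = state′ ; state-0 = refl ; move = move′ ; forced = forced′ }
  where
  state′ : ℕ → Assignment _
  state′ zero    = 2 + x ∷ y ∷ ys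
  state′ (suc t) = state run t

  only-head : ∀ e B → Move e (2 + x ∷ y ∷ ys) B → toℕ e ≡ edge 0 × B ≡ state run 0
  only-head zero    _ (_ , refl) = sym e₀ , sym (state-0 run)
  only-head (suc e) _ (2≤ , _)   = ⊥-elim (sparse-no-move sp e _ (2≤ , refl))

  move′ : ∀ t → t < suc (steps run)
        → Σ (Fin _) λ e → toℕ e ≡ edge t × Move e (state′ t) (state′ (suc t))
  move′ zero    _        = zero , sym e₀ , s≤s (s≤s z≤n) , state-0 run
  move′ (suc t) (s≤s t<) = move run t t<

  forced′ : ∀ t → t ≤ suc (steps run) → ∀ e B → Move e (state′ t) B
          → t < suc (steps run) × toℕ e ≡ edge t × B ≡ state′ (suc t)
  forced′ zero    _        e B mv = s≤s z≤n , only-head e B mv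
  forced′ (suc t) (s≤s t≤) e B mv = map s≤s id (forced run t t≤ e B mv)

prepend-vertex : ∀ {k x} {xs : Assignment k} {edge} → x ≤ 1
  → ForcedRun xs edge → ForcedRun {suc k} (x ∷ xs) (suc ∘ edge)
prepend-vertex {x = x} {edge = edge} x≤1 run = record
  { steps = steps run ; state = (x ∷_) ∘ state run ; state-0 = cong (x ∷_) (state-0 run)
  ; move = move′ ; forced = forced′ }
  where
  move′ : ∀ t → t < steps run
        → Σ (Fin _) λ e → toℕ e ≡ suc (edge t) × Move e (x ∷ state run t) (x ∷ state run (suc t))
  move′ t t< with move run t t<
  ... | e , e≡ , 2≤ , B≡ = suc e , cong suc e≡ , 2≤ , cong (x ∷_) B≡

  forced′ : ∀ t → t ≤ steps run → ∀ e B → Move e (x ∷ state run t) B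
          → t < steps run × toℕ e ≡ suc (edge t) × B ≡ x ∷ state run (suc t)
  forced′ t t≤ zero    _ (2≤x , _)  = ⊥-elim (<⇒≱ 2≤x x≤1)
  forced′ t t≤ (suc e) _ (2≤ , refl) with forced run t t≤ e _ (2≤ , refl)
  ... | t< , e≡ , B≡ = t< , cong suc e≡ , cong (x ∷_) B≡

cascade : ∀ {n} (ys : Vec ℕ n) → Sparse ys → ForcedRun (2 ∷ ys) id
cascade []           _           = stuck-run tt
cascade (y ∷ [])     _           = head-move tt refl (stuck-run (z≤n , tt))
cascade (y ∷ z ∷ zs) (y≤1 , sp) = head-move (y≤1 , sp) refl (carry y y≤1 (cascade (z ∷ zs) sp))
  where
  carry : ∀ y → y ≤ 1 → ForcedRun (2 ∷ z ∷ zs) id → ForcedRun (0 ∷ suc y ∷ z ∷ zs) suc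
  carry zero          _        _    = stuck-run (z≤n , s≤s z≤n , sp)
  carry (suc zero)    _        rest = prepend-vertex z≤n rest
  carry (suc (suc _)) (s≤s ()) _

overload-run : ∀ {n r} {ys : Vec ℕ n} → r ≤ 1 → Sparse ys
  → Σ (ForcedRun (4 + r ∷ 0 ∷ ys) pred) λ run → 2 ≤ steps run
overload-run {ys = ys} r≤1 sp =
  head-move (sparse-∷ z≤n sp) refl
    (head-move (sparse-∷ ≤-refl sp) refl (prepend-vertex r≤1 (cascade ys sp)))
  , s≤s (s≤s z≤n)

special-run : ∀ {k} (S : Assignment k) (j : Fin k)
  → (lookup S (inject₁ j) ≡ 4) ⊎ (lookup S (inject₁ j) ≡ 5)
  → lookup S (suc j) ≡ 0
  → (∀ i → i ≢ j → inject₁ i ≢ suc j → lookup S (inject₁ i) ≤ 1)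
  → Σ (ForcedRun S (λ t → toℕ j + pred t)) λ run → 2 ≤ steps run
special-run (x ∷ 0 ∷ ys) zero load refl small = overload load
  where
  sparse-beyond : ∀ {n} (zs : Vec ℕ n)
    → (∀ i → i ≢ zero → inject₁ i ≢ suc zero → lookup (x ∷ 0 ∷ zs) (inject₁ i) ≤ 1) → Sparse zs
  sparse-beyond []       _      = tt
  sparse-beyond (z ∷ zs) small′ =
    sparse-from-lookup (z ∷ zs) λ i → small′ (suc (suc i)) (λ ()) (λ ())

  overload : (x ≡ 4) ⊎ (x ≡ 5) → Σ (ForcedRun (x ∷ 0 ∷ ys) pred) λ run → 2 ≤ steps run
  overload (inj₁ refl) = overload-run z≤n    (sparse-beyond ys small)
  overload (inj₂ refl) = overload-run ≤-refl (sparse-beyond ys small)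
special-run (x ∷ xs) (suc j) load empty small =
  map (prepend-vertex (small zero (λ ()) (λ ()))) id
    (special-run xs j load empty λ i i≢j i≢j+1 →
      small (suc i) (i≢j ∘ suc-injective) (i≢j+1 ∘ suc-injective))

move-sum : ∀ {k} (e : Fin k) (A B : Assignment k) → Move e A B → suc (sum B) ≡ sum A
move-sum zero    (suc (suc x) ∷ y ∷ zs) _ (s≤s (s≤s _) , refl) = cong suc (+-suc x (y + sum zs))
move-sum (suc e) (x ∷ xs)               _ (2≤ , refl)          =
  trans (sym (+-suc x _)) (cong (x +_) (move-sum e xs _ (2≤ , refl)))

module _ {k} {A : Assignment k} {edge : ℕ → ℕ} (run : ForcedRun A edge) where

  sum-state : ∀ t → t ≤ steps run → sum (state run t) + t ≡ sum A
  sum-state zero    _  = trans (+-identityʳ _) (cong sum (state-0 run))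
  sum-state (suc t) t< with move run t t<
  ... | e , _ , mv = begin
    sum (state run (suc t)) + suc t  ≡⟨ +-suc _ t ⟩
    suc (sum (state run (suc t))) + t ≡⟨ cong (_+ t) (move-sum e _ _ mv) ⟩
    sum (state run t) + t            ≡⟨ sum-state t (<⇒≤ t<) ⟩
    sum A                            ∎
    where open ≡-Reasoning

  state-injective : ∀ t t′ → t ≤ steps run → t′ ≤ steps run → state run t ≡ state run t′ → t ≡ t′
  state-injective t t′ t≤ t′≤ eq = +-cancelˡ-≡ (sum (state run t)) t t′
    (trans (sum-state t t≤) (sym (trans (cong (λ B → sum B + t′) eq) (sum-state t′ t′≤))))

  state-reachable : ∀ t → t ≤ steps run → Reachable A (state run t)
  state-reachable zero    _  = subst (Reachable A) (sym (state-0 run)) ε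
  state-reachable (suc t) t< with move run t t<
  ... | e , _ , mv = state-reachable t (<⇒≤ t<) ◅◅ ((e , mv) ◅ ε)

  reachable-from-state : ∀ {t B} → t ≤ steps run → Reachable (state run t) B
    → ∃ λ t′ → t′ ≤ steps run × state run t′ ≡ B
  reachable-from-state {t} t≤ ε = t , t≤ , refl
  reachable-from-state {t} t≤ ((e , mv) ◅ r) with forced run t t≤ e _ mv
  ... | t< , _ , refl = reachable-from-state t< r

  reachable-is-state : ∀ {B} → Reachable A B → ∃ λ t → t ≤ steps run × state run t ≡ B
  reachable-is-state r =
    reachable-from-state z≤n (subst (λ C → Reachable C _) (sym (state-0 run)) r)

  edge< : ∀ t → t < steps run → edge t < k
  edge< t t< with move run t t<
  ... | e , e≡ , _ = subst (_< k) e≡ (toℕ<n e)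

  traversable⇔ : ∀ e → Traversable A e ⇔ (∃ λ t → t < steps run × toℕ e ≡ edge t)
  traversable⇔ e = mk⇔ to from
    where
    to : Traversable A e → ∃ λ t → t < steps run × toℕ e ≡ edge t
    to (B , r , 2≤) with reachable-is-state r
    ... | t , t≤ , refl with forced run t t≤ e _ (2≤ , refl)
    ... | t< , e≡ , _ = t , t< , e≡

    from : (∃ λ t → t < steps run × toℕ e ≡ edge t) → Traversable A e
    from (t , t< , e≡) with move run t t<
    ... | e′ , e′≡ , 2≤ , _ with toℕ-injective (trans e≡ (sym e′≡))
    ... | refl = state run t , state-reachable t (<⇒≤ t<) , 2≤

  path-iso : steps run ≡ k → PathIsoAssignmentGraph A
  path-iso steps≡k = state run ∘ toℕ , reachable , onto , injective , step⇔
    where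
    in-run : ∀ (i : Fin (suc k)) → toℕ i ≤ steps run
    in-run i = subst (toℕ i ≤_) (sym steps≡k) (≤-pred (toℕ<n i))

    reachable : ∀ i → Reachable A (state run (toℕ i))
    reachable i = state-reachable (toℕ i) (in-run i)

    onto : ∀ B → Reachable A B → ∃ λ i → state run (toℕ i) ≡ B
    onto B r with reachable-is-state r
    ... | t , t≤ , eq = fromℕ< t<1+k , trans (cong (state run) (toℕ-fromℕ< t<1+k)) eq
      where
      t<1+k : t < suc k
      t<1+k = s≤s (subst (t ≤_) steps≡k t≤)

    injective : ∀ {i i′} → state run (toℕ i) ≡ state run (toℕ i′) → i ≡ i′
    injective {i} {i′} eq = toℕ-injective (state-injective _ _ (in-run i) (in-run i′) eq)

    step⇔ : ∀ i i′ → Step (state run (toℕ i)) (state run (toℕ i′)) ⇔ (toℕ i′ ≡ suc (toℕ i))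
    step⇔ i i′ = mk⇔ to from
      where
      to : Step (state run (toℕ i)) (state run (toℕ i′)) → toℕ i′ ≡ suc (toℕ i)
      to (e , mv) with forced run (toℕ i) (in-run i) e _ mv
      ... | i< , _ , eq = state-injective _ _ (in-run i′) i< eq

      from : toℕ i′ ≡ suc (toℕ i) → Step (state run (toℕ i)) (state run (toℕ i′))
      from eq with move run (toℕ i) (subst (_≤ steps run) eq (in-run i′))
      ... | e , _ , mv = e , subst (Move e _) (cong (state run) (sym eq)) mv

tail-interval : ∀ {k s} {T : Subset k} {a l a′ l′}
  → (∀ n → (a ≤ suc n × suc n < a + l) ⇔ (a′ ≤ n × n < a′ + l′))
  → (∀ e → e ∈ s ∷ T ⇔ (a ≤ toℕ e × toℕ e < a + l))
  → ∀ e → e ∈ T ⇔ (a′ ≤ toℕ e × toℕ e < a′ + l′)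
tail-interval shift mem e = shift (toℕ e) ⇔-∘ (mem (suc e) ⇔-∘ mk⇔ there drop-there)

interval-size : ∀ {k} (T : Subset k) a l → a + l ≤ k
  → (∀ e → e ∈ T ⇔ (a ≤ toℕ e × toℕ e < a + l)) → ∣ T ∣ ≡ l
interval-size []            a       l       a+l≤0 _   = sym (n≤0⇒n≡0 (m+n≤o⇒n≤o a a+l≤0))
interval-size (inside  ∷ T) (suc a) l       _     mem =
  ⊥-elim (n≮0 (proj₁ (Equivalence.to (mem zero) here)))
interval-size (outside ∷ T) (suc a) l       a+l<k mem =
  interval-size T a l (≤-pred a+l<k)
    (tail-interval (λ _ → mk⇔ (map ≤-pred ≤-pred) (map s≤s s≤s)) mem)
interval-size (inside  ∷ T) zero    zero    _     mem =
  ⊥-elim (n≮0 (proj₂ (Equivalence.to (mem zero) here)))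
interval-size (outside ∷ T) zero    zero    _     mem =
  interval-size T 0 0 z≤n (tail-interval (λ _ → mk⇔ (λ { (_ , ()) }) (λ { (_ , ()) })) mem)
interval-size (inside  ∷ T) zero    (suc l) l<k   mem =
  cong suc (interval-size T 0 l (≤-pred l<k)
    (tail-interval (λ _ → mk⇔ (map (λ _ → z≤n) ≤-pred) (map (λ _ → z≤n) s≤s)) mem))
interval-size (outside ∷ T) zero    (suc l) _     mem with Equivalence.from (mem zero) (z≤n , s≤s z≤n)
... | ()

offset-pred⇔interval : ∀ a s x → 2 ≤ s
  → (∃ λ t → t < s × x ≡ a + pred t) ⇔ (a ≤ x × x < a + pred s)
offset-pred⇔interval a (suc (suc s)) x (s≤s (s≤s z≤n)) = mk⇔ to from
  where
  to : (∃ λ t → t < 2 + s × x ≡ a + pred t) → a ≤ x × x < a + suc s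
  to (t , t< , refl) = m≤m+n a (pred t) , +-monoʳ-< a (s≤s (pred-mono-≤ (≤-pred t<)))

  from : a ≤ x × x < a + suc s → ∃ λ t → t < 2 + s × x ≡ a + pred t
  from (a≤x , x<) = suc (x ∸ a) , s≤s (m<n+o⇒m∸n<o x a x<) , sym (m+[n∸m]≡n a≤x)

offset-pred-bound : ∀ a s k → 2 ≤ s → (∀ t → t < s → a + pred t < k) → a + pred s ≤ k
offset-pred-bound a (suc (suc s)) k (s≤s (s≤s z≤n)) below =
  subst (_≤ k) (sym (+-suc a s)) (below (suc s) ≤-refl)

pred≡1+n∸2⇒≡ : ∀ s k → 2 ≤ s → pred s ≡ suc k ∸ 2 → s ≡ k
pred≡1+n∸2⇒≡ (suc (suc s)) (suc k) (s≤s (s≤s z≤n)) eq = cong suc eq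
pred≡1+n∸2⇒≡ (suc (suc s)) zero    (s≤s (s≤s z≤n)) ()

lemma7p2 : (k : ℕ) (S : Assignment k) (j : Fin k) (m : ℕ)
    → IsSpecialAssignment S j m
    → ExactlyTraversable S (suc k ∸ 2)
    → PathIsoAssignmentGraph S
lemma7p2 k S j m (load , empty , small , _) (T , T⇔traversable , ∣T∣≡) =
  path-iso run (pred≡1+n∸2⇒≡ (steps run) k 2≤steps (trans (sym ∣T∣≡pred-steps) ∣T∣≡))
  where
  run : ForcedRun S (λ t → toℕ j + pred t)
  run = proj₁ (special-run S j load empty small)

  2≤steps : 2 ≤ steps run
  2≤steps = proj₂ (special-run S j load empty small)

  T-interval : ∀ e → e ∈ T ⇔ (toℕ j ≤ toℕ e × toℕ e < toℕ j + pred (steps run))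
  T-interval e = offset-pred⇔interval (toℕ j) (steps run) (toℕ e) 2≤steps
    ⇔-∘ (traversable⇔ run e ⇔-∘ T⇔traversable e)

  ∣T∣≡pred-steps : ∣ T ∣ ≡ pred (steps run)
  ∣T∣≡pred-steps = interval-size T (toℕ j) (pred (steps run))
    (offset-pred-bound (toℕ j) (steps run) k 2≤steps (edge< run)) T-interval
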